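{- Let $G$ be an undirected graph, let $k$ be a positive integer, and let $A\subseteq B\subseteq V(G)$ be such that (i) $B$ is a $k$-step dominating set in $G$, (ii) $G/B$ is $2$-edge connected, and (iii) $N(A)\cup B$ is a $(k-1)$-step dominating set of $G$. Then there exists an oriented subgraph $\vec{H}$ of $G\setminus G[B]$ such that (i) $N(A)\setminus B\subseteq V(\vec{H})$, and hence $V(\vec{H})\cup B$ is a $(k-1)$-step dominating set of $G$; and (ii) for every $v\in V(\vec{H})$ we have $d_{\vec{H}}(A,v)\le 2k$, and either $d_{\vec{H}}(v,A)\le 2k$ or $d_{\vec{H}}(v,B\setminus A)\le 2k-1$.
   Context: A set $D\subseteq V(G)$ is a $k$-step dominating set of $G$ if every vertex not in $D$ is at distance at most $k$ in $G$ from some vertex of $D$. $N(A)$ is the set of all vertices having an edge to some vertex of $A$. $G/B$ is the graph obtained from $G$ by contracting $B$ to a single vertex. $G\setminus G[B]$ denotes $G$ with the edges of the induced subgraph $G[B]$ removed. An oriented subgraph is a subgraph each of whose edges is given one direction. For vertex sets $X,Y$ of an oriented graph $\vec{H}$, $d_{\vec{H}}(X,Y)$ is the minimum length of a directed path in $\vec{H}$ from a vertex of $X$ to a vertex of $Y$ (for a single vertex $v$, $X=\{v\}$). -}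

module Defs where

open import Data.Nat using (ℕ; zero; suc; _≤_; _∸_; _*_)
open import Data.Fin using (Fin)
open import Data.Fin.Subset using (Subset; _∈_; _∉_)
open import Data.Product using (Σ; ∃; ∃-syntax; _×_; _,_)
open import Data.Sum using (_⊎_)
open import Data.Empty using (⊥)
open import Relation.Nullary using (¬_; Dec)
open import Relation.Binary.PropositionalEquality using (_≡_)

record Graph (n : ℕ) : Set₁ where
  field
    Adj     : Fin n → Fin n → Set
    sym     : ∀ {u v} → Adj u v → Adj v u
    irrefl  : ∀ {u} → ¬ Adj u u
    adj?    : ∀ u v → Dec (Adj u v)
open Graph public

data Walk {n : ℕ} (R : Fin n → Fin n → Set) : Fin n → Fin n → ℕ → Set where
  [] : ∀ {v} → Walk R v v zero
  _∷_ : ∀ {u w v ℓ} → R u w → Walk R w v ℓ → Walk R u v (suc ℓ)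

DistLe : ∀ {n} → Graph n → Fin n → Fin n → ℕ → Set
DistLe G u v d = ∃[ ℓ ] (ℓ ≤ d × Walk (Adj G) u v ℓ)

StepDominating : ∀ {n} → Graph n → ℕ → (Fin n → Set) → Set
StepDominating G k D = ∀ v → ¬ D v → ∃[ u ] (D u × DistLe G u v k)

Nbh : ∀ {n} → Graph n → Subset n → Fin n → Set
Nbh G A v = ∃[ a ] (a ∈ A × Adj G v a)

-- Vertices of G/B are represented by vertices of G, all vertices of B
-- representing the contracted vertex; edges of G/B are the edges of G
-- (edges inside B become loops, irrelevant for connectivity).
data ContrWalk {n : ℕ} (G : Graph n) (B : Subset n)
               (Deleted : Fin n → Fin n → Set) : Fin n → Fin n → Set where
  here  : ∀ {v} → ContrWalk G B Deleted v v
  step  : ∀ {u w v} → Adj G u w → ¬ Deleted u w →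
          ContrWalk G B Deleted w v → ContrWalk G B Deleted u v
  merge : ∀ {u w v} → u ∈ B → w ∈ B →
          ContrWalk G B Deleted w v → ContrWalk G B Deleted u v

NoEdge : ∀ {n} → Fin n → Fin n → Set
NoEdge u v = ⊥

IsEdge : ∀ {n} → Fin n → Fin n → Fin n → Fin n → Set
IsEdge a b u v = (u ≡ a × v ≡ b) ⊎ (u ≡ b × v ≡ a)

ContrConnected : ∀ {n} → Graph n → Subset n → (Fin n → Fin n → Set) → Set
ContrConnected G B Del = ∀ u v → ContrWalk G B Del u v

-- G/B is 2-edge-connected: connected, and remains connected after deleting
-- any one of its edges (= any edge of G not inside B; parallel edges of G/B
-- come from distinct edges of G).
TwoEdgeConnectedContr : ∀ {n} → Graph n → Subset n → Set
TwoEdgeConnectedContr G B =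
  ContrConnected G B NoEdge ×
  (∀ a b → Adj G a b → ¬ (a ∈ B × b ∈ B) → ContrConnected G B (IsEdge a b))

record OrientedSubgraph {n : ℕ} (G : Graph n) (B : Subset n) : Set₁ where
  field
    VH       : Fin n → Set
    Arc      : Fin n → Fin n → Set
    arc-tail : ∀ {u v} → Arc u v → VH u
    arc-head : ∀ {u v} → Arc u v → VH v
    arc-edge : ∀ {u v} → Arc u v → Adj G u v
    arc-notB : ∀ {u v} → Arc u v → ¬ (u ∈ B × v ∈ B)
    oriented : ∀ {u v} → Arc u v → ¬ Arc v u
open OrientedSubgraph public

DDistLe : ∀ {n} {G : Graph n} {B : Subset n} → OrientedSubgraph G B →
          (Fin n → Set) → (Fin n → Set) → ℕ → Set
DDistLe H X Y d =
  ∃[ x ] ∃[ y ] (X x × Y y × VH H x × VH H y ×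
    ∃[ ℓ ] (ℓ ≤ d × Walk (Arc H) x y ℓ))

InSub : ∀ {n} → Subset n → Fin n → Set
InSub S v = v ∈ S

Single : ∀ {n} → Fin n → Fin n → Set
Single v w = w ≡ v

Union : ∀ {n} → (Fin n → Set) → (Fin n → Set) → Fin n → Set
Union P Q v = P v ⊎ Q v

Minus : ∀ {n} → (Fin n → Set) → (Fin n → Set) → Fin n → Set
Minus P Q v = P v × ¬ Q v

SubsetOf : ∀ {n} → Subset n → Subset n → Set
SubsetOf A B = ∀ {v} → v ∈ A → v ∈ B

{-# OPTIONS --safe #-}
module Submission where

-- Give every vertex the level min(d(u, A), 1 + d(u, B)), which is at most k by (iii), and
-- let each vertex outside B point to a neighbour one level lower; on N(A) \ B this parent
-- lies in A.  Vertices v of N(A) \ B are covered one at a time by ears: since G/B stays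
-- connected without the tree edge v – parent v, some other edge x y leaves the subtree of v.
-- The tree path from v down to x and the tree path from y up to the first vertex that is
-- already covered or in B are oriented one away from A and one towards B, and joined by x y.
-- Every vertex of the result then lies on a tree path oriented away from A, followed by a
-- cross edge and a tree path oriented towards B; since tree paths descend through levels
-- ≤ k, both walks have length at most 2k.

open import Defs
open import Data.Nat using (ℕ; zero; suc; _≤_; _<_; _*_; _∸_; _+_; z≤n; s≤s; _≤′_; ≤′-reflexive; ≤′-step)
open import Data.Nat.Properties
open import Data.Fin using (Fin)
open import Data.Fin.Properties using (any?)
open import Data.Fin.Subset using (Subset; _∈_; _∉_)
open import Data.Fin.Subset.Properties using (_∈?_)
open import Data.Product using (Σ; ∃-syntax; _×_; _,_; proj₁; proj₂)
open import Data.Sum using (_⊎_; inj₁; inj₂; [_,_]′; map; map₁; map₂)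
open import Data.Empty using (⊥; ⊥-elim)
open import Data.List using ([]; _∷_; allFin)
open import Data.List.Membership.Propositional using () renaming (_∈_ to _∈ₗ_)
open import Data.List.Membership.Propositional.Properties using (∈-allFin)
open import Data.List.Relation.Unary.Any using (here; there)
open import Function using (_∘_)
open import Relation.Nullary using (¬_; Dec; yes; no)
open import Relation.Nullary.Decidable using (_×-dec_; _⊎-dec_; ¬?)
open import Relation.Binary.PropositionalEquality
  using (_≡_; _≢_; refl; cong; subst) renaming (sym to ≡-sym)

m+n≤o⇒m≤o∸1 : ∀ {m n o} → 1 ≤ n → m + n ≤ o → m ≤ o ∸ 1
m+n≤o⇒m≤o∸1 {m} 1≤n h = m+n≤o⇒m≤o∸n m (≤-trans (+-monoʳ-≤ m 1≤n) h)

m+n≤o⇒1+m+n′≤o : ∀ {m n n′ o} → n′ < n → m + n ≤ o → suc m + n′ ≤ o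
m+n≤o⇒1+m+n′≤o {m} {n′ = n′} n′<n h =
  ≤-trans (≤-reflexive (≡-sym (+-suc m n′))) (≤-trans (+-monoʳ-≤ m n′<n) h)

module _ {P : ℕ → Set} (P? : ∀ j → Dec (P j)) (P-suc : ∀ {j} → P j → P (suc j)) where

  upward-closed : ∀ {i j} → i ≤ j → P i → P j
  upward-closed i≤j = go (≤⇒≤′ i≤j)
    where
    go : ∀ {i j} → i ≤′ j → P i → P j
    go (≤′-reflexive refl) p = p
    go (≤′-step i≤′j) p = P-suc (go i≤′j p)

  least-witness : ∀ {m} → P m → ∃[ j ] (P j × (∀ {i} → P i → j ≤ i))
  least-witness {zero} p = 0 , p , λ _ → z≤n
  least-witness {suc m} p with P? m
  ... | yes q = least-witness q
  ... | no ¬q = suc m , p , λ q′ → ≰⇒> (λ i≤m → ¬q (upward-closed i≤m q′))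

walk-snoc : ∀ {n} {R : Fin n → Fin n → Set} {a u w ℓ} → Walk R a u ℓ → R u w → Walk R a w (suc ℓ)
walk-snoc [] e = e ∷ []
walk-snoc (e′ ∷ walk) e = e′ ∷ walk-snoc walk e

stepDominating-mono : ∀ {n} {G : Graph n} {d} {D D′ : Fin n → Set} →
  (∀ {v} → D v → D′ v) → StepDominating G d D → StepDominating G d D′
stepDominating-mono D⊆D′ dom v ¬D′v with dom v (¬D′v ∘ D⊆D′)
... | u , Du , dist = u , D⊆D′ Du , dist

leaving-edge : ∀ {n} {G : Graph n} {B : Subset n} {Del : Fin n → Fin n → Set} {X : Fin n → Set} {s t} →
  (∀ u → Dec (X u)) → (∀ {u} → X u → u ∉ B) → ContrWalk G B Del s t → X s → ¬ X t →
  ∃[ x ] ∃[ y ] (X x × ¬ X y × Adj G x y × ¬ Del x y)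
leaving-edge X? X∩B=∅ here Xs ¬Xt = ⊥-elim (¬Xt Xs)
leaving-edge X? X∩B=∅ (step {w = w} e ¬del walk) Xs ¬Xt with X? w
... | yes Xw = leaving-edge X? X∩B=∅ walk Xw ¬Xt
... | no ¬Xw = _ , w , Xs , ¬Xw , e , ¬del
leaving-edge X? X∩B=∅ (merge u∈B _ _) Xs _ = ⊥-elim (X∩B=∅ Xs u∈B)

nbh? : ∀ {n} (G : Graph n) (A : Subset n) v → Dec (Nbh G A v)
nbh? G A v = any? λ a → (a ∈? A) ×-dec adj? G v a

record Layering {n} (G : Graph n) (k : ℕ) (A B : Subset n) : Set where
  field
    level        : Fin n → ℕ
    parent       : Fin n → Fin n
    level≤k      : ∀ u → level u ≤ k
    level≥1      : ∀ {u} → u ∉ A → 1 ≤ level u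
    parent-adj   : ∀ {u} → u ∉ B → Adj G u (parent u)
    parent-level : ∀ {u} → u ∉ B → level (parent u) < level u
    parent-A     : ∀ {u} → Nbh G A u → u ∉ B → parent u ∈ A

module _ {n} {G : Graph n} {A B : Subset n} where

  -- Level≤ j u  iff  d(u, A) ≤ j  or  d(u, B) < j.
  Level≤ : ℕ → Fin n → Set
  Level≤ zero u = u ∈ A
  Level≤ (suc j) u = Level≤ j u ⊎ (u ∈ B ⊎ ∃[ w ] (Adj G u w × Level≤ j w))

  level≤? : ∀ u j → Dec (Level≤ j u)
  level≤? u zero = u ∈? A
  level≤? u (suc j) = level≤? u j ⊎-dec (u ∈? B ⊎-dec any? λ w → adj? G u w ×-dec level≤? w j)

  walk-level≤ : ∀ {j s t ℓ} → Level≤ j s → Walk (Adj G) s t ℓ → Level≤ (ℓ + j) t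
  walk-level≤ r [] = r
  walk-level≤ {j} {t = t} {ℓ = suc ℓ} r (e ∷ walk) =
    subst (λ i → Level≤ i t) (+-suc ℓ j) (walk-level≤ (inj₂ (inj₂ (_ , sym G e , r))) walk)

  near⇒level≤1 : ∀ {u} → Union (Nbh G A) (InSub B) u → Level≤ 1 u
  near⇒level≤1 (inj₁ (a , a∈A , e)) = inj₂ (inj₂ (a , e , a∈A))
  near⇒level≤1 (inj₂ u∈B) = inj₂ (inj₁ u∈B)

  dominated⇒level≤ : ∀ {k} → 1 ≤ k → StepDominating G (k ∸ 1) (Union (Nbh G A) (InSub B)) →
    ∀ u → Level≤ k u
  dominated⇒level≤ {k} 1≤k dom u with nbh? G A u ⊎-dec u ∈? B
  ... | yes near = upward-closed (level≤? u) inj₁ 1≤k (near⇒level≤1 near)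
  ... | no far with dom u far
  ...   | w , near , ℓ , ℓ≤k-1 , walk =
    upward-closed (level≤? u) inj₁ ℓ+1≤k (walk-level≤ (near⇒level≤1 near) walk)
    where
    ℓ+1≤k : ℓ + 1 ≤ k
    ℓ+1≤k = ≤-trans (+-monoˡ-≤ 1 ℓ≤k-1) (≤-reflexive (m∸n+n≡m 1≤k))

  layering : ∀ {k} → 1 ≤ k → SubsetOf A B → StepDominating G (k ∸ 1) (Union (Nbh G A) (InSub B)) →
    Layering G k A B
  layering {k} 1≤k A⊆B dom = record
    { level        = level
    ; parent       = λ u → proj₁ (descend u)
    ; level≤k      = λ u → level-least (dominated⇒level≤ 1≤k dom u)
    ; level≥1      = level≥1
    ; parent-adj   = λ u∉B → proj₁ (proj₂ (descend _) u∉B)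
    ; parent-level = λ u∉B → proj₂ (proj₂ (descend _) u∉B)
    ; parent-A     = λ nbh u∉B → level≤0⇒A
        (≤-pred (≤-trans (proj₂ (proj₂ (descend _) u∉B)) (level-least (near⇒level≤1 (inj₁ nbh)))))
    }
    where
    least : ∀ u → ∃[ j ] (Level≤ j u × ∀ {i} → Level≤ i u → j ≤ i)
    least u = least-witness (level≤? u) inj₁ (dominated⇒level≤ 1≤k dom u)

    level : Fin n → ℕ
    level u = proj₁ (least u)

    at-level : ∀ u → Level≤ (level u) u
    at-level u = proj₁ (proj₂ (least u))

    level-least : ∀ {u i} → Level≤ i u → level u ≤ i
    level-least {u} = proj₂ (proj₂ (least u))

    level≥1 : ∀ {u} → u ∉ A → 1 ≤ level u
    level≥1 {u} u∉A with level u | at-level u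
    ... | zero | u∈A = ⊥-elim (u∉A u∈A)
    ... | suc _ | _ = s≤s z≤n

    level≤0⇒A : ∀ {u} → level u ≤ 0 → u ∈ A
    level≤0⇒A {u} h with level u | at-level u
    ... | zero | u∈A = u∈A
    level≤0⇒A () | suc _ | _

    lower-neighbour : ∀ {u} j → u ∉ B → Level≤ j u → (∀ {i} → Level≤ i u → j ≤ i) →
      ∃[ w ] (Adj G u w × level w < j)
    lower-neighbour zero u∉B u∈A _ = ⊥-elim (u∉B (A⊆B u∈A))
    lower-neighbour (suc j) _ (inj₁ r) minimal = ⊥-elim (1+n≰n (minimal r))
    lower-neighbour (suc j) u∉B (inj₂ (inj₁ u∈B)) _ = ⊥-elim (u∉B u∈B)
    lower-neighbour (suc j) _ (inj₂ (inj₂ (w , e , r))) _ = w , e , s≤s (level-least r)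

    -- The parent of a vertex of B is junk (the vertex itself).
    descend : ∀ u → Σ (Fin n) λ w → u ∉ B → Adj G u w × level w < level u
    descend u = descend-by (u ∈? B)
      where
      descend-by : Dec (u ∈ B) → Σ (Fin n) λ w → u ∉ B → Adj G u w × level w < level u
      descend-by (yes u∈B) = u , λ u∉B → ⊥-elim (u∉B u∈B)
      descend-by (no u∉B) with lower-neighbour (level u) u∉B (at-level u) level-least
      ... | w , e , lt = w , λ _ → e , lt

module Forest {n} {G : Graph n} {k} {A B : Subset n} (A⊆B : SubsetOf A B) (L : Layering G k A B) where
  open Layering L

  ∉B⇒∉A : ∀ {u} → u ∉ B → u ∉ A
  ∉B⇒∉A u∉B = u∉B ∘ A⊆B

  child-level : ∀ {c u} → c ∉ B → parent c ≡ u → level u < level c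
  child-level c∉B refl = parent-level c∉B

  parent-no-2-cycle : ∀ {u v} → u ∉ B → v ∉ B → parent u ≡ v → parent v ≡ u → ⊥
  parent-no-2-cycle u∉B v∉B pu≡v pv≡u = <-asym (child-level u∉B pu≡v) (child-level v∉B pv≡u)

  parent-rec : (Q : Fin n → Set) → (∀ u → (u ∉ B → Q (parent u)) → Q u) → ∀ u → Q u
  parent-rec Q from-parent u = go (level u) u ≤-refl
    where
    go : ∀ m u → level u ≤ m → Q u
    go zero u h = from-parent u λ u∉B → ⊥-elim (1+n≰n (≤-trans (level≥1 (∉B⇒∉A u∉B)) h))
    go (suc m) u h = from-parent u λ u∉B → go m (parent u) (≤-pred (≤-trans (parent-level u∉B) h))

  child-rec : (Q : Fin n → Set) → (∀ u → (∀ {c} → c ∉ B → parent c ≡ u → Q c) → Q u) → ∀ u → Q u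
  child-rec Q from-children u = go k u (m≤n+m k (level u))
    where
    go : ∀ m u → k ≤ level u + m → Q u
    go zero u h = from-children u λ {c} c∉B c↑u →
      ⊥-elim (<⇒≱ (child-level c∉B c↑u) (≤-trans (level≤k c) (subst (k ≤_) (+-identityʳ _) h)))
    go (suc m) u h = from-children u λ {c} c∉B c↑u →
      go m c (≤-trans h (≤-trans (≤-reflexive (+-suc _ m)) (+-monoˡ-≤ m (child-level c∉B c↑u))))

  data Ancestor (P : Fin n → Set) (v : Fin n) : Fin n → Set where
    here : Ancestor P v v
    up   : ∀ {u} → P u → Ancestor P v (parent u) → Ancestor P v u

  module _ {P : Fin n → Set} where

    ancestor-trans : ∀ {v u w} → Ancestor P v u → Ancestor P u w → Ancestor P v w
    ancestor-trans a here = a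
    ancestor-trans a (up p b) = up p (ancestor-trans a b)

    ancestor-child : ∀ {u x} → Ancestor P u x → u ≡ x ⊎ ∃[ c ] (Ancestor P c x × parent c ≡ u × P c)
    ancestor-child here = inj₁ refl
    ancestor-child (up px a) with ancestor-child a
    ... | inj₁ refl = inj₂ (_ , here , refl , px)
    ... | inj₂ (c , a′ , pc≡u , Pc) = inj₂ (c , up px a′ , pc≡u , Pc)

    ancestor-map : ∀ {Q : Fin n → Set} {v u} → (∀ {w} → P w → Q w) → Ancestor P v u → Ancestor Q v u
    ancestor-map P⇒Q here = here
    ancestor-map P⇒Q (up p a) = up (P⇒Q p) (ancestor-map P⇒Q a)

    module _ (P⇒∉B : ∀ {u} → P u → u ∉ B) where

      ancestor-∉B : ∀ {v u} → v ∉ B → Ancestor P v u → u ∉ B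
      ancestor-∉B v∉B here = v∉B
      ancestor-∉B _ (up p _) = P⇒∉B p

      ancestor? : (∀ u → Dec (P u)) → ∀ v u → Dec (Ancestor P v u)
      ancestor? P? v = parent-rec (λ u → Dec (Ancestor P v u)) decide
        where
        decide : ∀ u → (u ∉ B → Dec (Ancestor P v (parent u))) → Dec (Ancestor P v u)
        decide u rec with u Data.Fin.≟ v
        ... | yes refl = yes here
        ... | no u≢v with P? u
        ...   | no ¬Pu = no λ { here → u≢v refl ; (up Pu _) → ¬Pu Pu }
        ...   | yes Pu with rec (P⇒∉B Pu)
        ...     | yes a = yes (up Pu a)
        ...     | no ¬a = no λ { here → u≢v refl ; (up _ a) → ¬a a }

  module _ {Q : Fin n → Set} where

    first-ancestor : (∀ u → Dec (Q u)) → (∀ {u} → u ∈ B → Q u) →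
      ∀ u → ∃[ w ] (Ancestor (λ z → ¬ Q z) w u × Q w)
    first-ancestor Q? B⊆Q = parent-rec _ climb
      where
      climb : ∀ u → (u ∉ B → ∃[ w ] (Ancestor (λ z → ¬ Q z) w (parent u) × Q w)) →
        ∃[ w ] (Ancestor (λ z → ¬ Q z) w u × Q w)
      climb u rec with Q? u
      ... | yes Qu = u , here , Qu
      ... | no ¬Qu with rec (¬Qu ∘ B⊆Q)
      ...   | w , a , Qw = w , up ¬Qu a , Qw

    first-ancestor-unique : ∀ {w z y} → Ancestor (λ z → ¬ Q z) w y → Q w →
      Ancestor (λ z → ¬ Q z) z y → Q z → z ≡ w
    first-ancestor-unique here _ here _ = refl
    first-ancestor-unique here Qw (up ¬Qy _) _ = ⊥-elim (¬Qy Qw)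
    first-ancestor-unique (up ¬Qy _) _ here Qz = ⊥-elim (¬Qy Qz)
    first-ancestor-unique (up _ a) Qw (up _ b) Qz = first-ancestor-unique a Qw b Qz

  record CrossEdge (Out In : Fin n → Set) (s t : Fin n) : Set where
    field
      tail-out    : Out s
      head-in     : In t ⊎ t ∈ B
      adjacent    : Adj G s t
      tail-parent : parent s ≢ t
      head-parent : t ∉ B → parent t ≢ s
  open CrossEdge

  crossEdge-map : ∀ {Out In Out′ In′ : Fin n → Set} {s t} →
    (∀ {u} → Out u → Out′ u) → (∀ {u} → In u → In′ u) → CrossEdge Out In s t → CrossEdge Out′ In′ s t
  crossEdge-map Out⊆Out′ In⊆In′ e = record
    { tail-out    = Out⊆Out′ (tail-out e)
    ; head-in     = map₁ In⊆In′ (head-in e)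
    ; adjacent    = adjacent e
    ; tail-parent = tail-parent e
    ; head-parent = head-parent e
    }

  -- The tree edge u – parent u is oriented parent u → u if Out u and u → parent u if In u;
  -- Cross collects the oriented non-tree edges.  Out-paths hang from A, In-paths drain
  -- into B, and every such path is continued by a cross edge, so each oriented vertex
  -- lies on a directed walk from A to B.
  record IsOrientation (Out In : Fin n → Set) (Cross : Fin n → Fin n → Set) : Set where
    field
      out∉B      : ∀ {u} → Out u → u ∉ B
      in∉B       : ∀ {u} → In u → u ∉ B
      out∩in     : ∀ {u} → Out u → ¬ In u
      out-parent : ∀ {u} → Out u → parent u ∈ A ⊎ Out (parent u)
      in-parent  : ∀ {u} → In u → parent u ∈ B ⊎ In (parent u)
      out-child  : ∀ {u} → Out u → ∃[ c ] (Out c × parent c ≡ u) ⊎ ∃[ t ] Cross u t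
      in-child   : ∀ {u} → In u → ∃[ c ] (In c × parent c ≡ u) ⊎ ∃[ s ] Cross s u
      cross      : ∀ {s t} → Cross s t → CrossEdge Out In s t

  record Orientation : Set₁ where
    field
      Out In        : Fin n → Set
      Out?          : ∀ u → Dec (Out u)
      In?           : ∀ u → Dec (In u)
      Cross         : Fin n → Fin n → Set
      isOrientation : IsOrientation Out In Cross
    open IsOrientation isOrientation public

    Covered : Fin n → Set
    Covered u = Out u ⊎ In u

    covered? : ∀ u → Dec (Covered u)
    covered? u = Out? u ⊎-dec In? u

    covered-parent : ∀ {u} → Covered u → parent u ∈ B ⊎ Covered (parent u)
    covered-parent (inj₁ o) = [ inj₁ ∘ A⊆B , inj₂ ∘ inj₁ ]′ (out-parent o)
    covered-parent (inj₂ i) = map₂ inj₂ (in-parent i)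

  ∅-orientation : Orientation
  ∅-orientation = record
    { Out = λ _ → ⊥ ; In = λ _ → ⊥ ; Out? = λ _ → no λ () ; In? = λ _ → no λ () ; Cross = λ _ _ → ⊥
    ; isOrientation = record
      { out∉B = λ () ; in∉B = λ () ; out∩in = λ () ; out-parent = λ () ; in-parent = λ ()
      ; out-child = λ () ; in-child = λ () ; cross = λ () }
    }

  _⊑_ : Orientation → Orientation → Set
  O ⊑ O′ = ∀ {u} → Orientation.Covered O u → Orientation.Covered O′ u

  -- New vertices: an Out-path whose deepest vertex is start, an In-path whose deepest
  -- vertex is end, and the cross edge start → end joining them.
  record Ear (O : Orientation) : Set₁ where
    open Orientation O
    field
      Out₁ In₁    : Fin n → Set
      Out₁?       : ∀ u → Dec (Out₁ u)
      In₁?        : ∀ u → Dec (In₁ u)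
      start end   : Fin n
      out₁-fresh  : ∀ {u} → Out₁ u → ¬ Covered u × u ∉ B
      in₁-fresh   : ∀ {u} → In₁ u → ¬ Covered u × u ∉ B
      out₁∩in₁    : ∀ {u} → Out₁ u → ¬ In₁ u
      out₁-parent : ∀ {u} → Out₁ u → parent u ∈ A ⊎ Union Out Out₁ (parent u)
      in₁-parent  : ∀ {u} → In₁ u → parent u ∈ B ⊎ Union In In₁ (parent u)
      out₁-child  : ∀ {u} → Out₁ u → u ≡ start ⊎ ∃[ c ] (Out₁ c × parent c ≡ u)
      in₁-child   : ∀ {u} → In₁ u → u ≡ end ⊎ ∃[ c ] (In₁ c × parent c ≡ u)
      bridge      : CrossEdge (Union Out Out₁) (Union In In₁) start end

  module _ {O : Orientation} (E : Ear O) where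
    open Orientation O
    open Ear E

    private
      Cross′ : Fin n → Fin n → Set
      Cross′ s t = Cross s t ⊎ (s ≡ start × t ≡ end)

      out∉B′ : ∀ {u} → Union Out Out₁ u → u ∉ B
      out∉B′ = [ out∉B , proj₂ ∘ out₁-fresh ]′

      in∉B′ : ∀ {u} → Union In In₁ u → u ∉ B
      in∉B′ = [ in∉B , proj₂ ∘ in₁-fresh ]′

      out∩in′ : ∀ {u} → Union Out Out₁ u → ¬ Union In In₁ u
      out∩in′ (inj₁ o) (inj₁ i) = out∩in o i
      out∩in′ (inj₁ o) (inj₂ i) = proj₁ (in₁-fresh i) (inj₁ o)
      out∩in′ (inj₂ o) (inj₁ i) = proj₁ (out₁-fresh o) (inj₂ i)
      out∩in′ (inj₂ o) (inj₂ i) = out₁∩in₁ o i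

      out-parent′ : ∀ {u} → Union Out Out₁ u → parent u ∈ A ⊎ Union Out Out₁ (parent u)
      out-parent′ = [ map₂ inj₁ ∘ out-parent , out₁-parent ]′

      in-parent′ : ∀ {u} → Union In In₁ u → parent u ∈ B ⊎ Union In In₁ (parent u)
      in-parent′ = [ map₂ inj₁ ∘ in-parent , in₁-parent ]′

      out-child′ : ∀ {u} → Union Out Out₁ u →
        ∃[ c ] (Union Out Out₁ c × parent c ≡ u) ⊎ ∃[ t ] Cross′ u t
      out-child′ (inj₁ o) with out-child o
      ... | inj₁ (c , oc , pc≡u) = inj₁ (c , inj₁ oc , pc≡u)
      ... | inj₂ (t , x) = inj₂ (t , inj₁ x)
      out-child′ (inj₂ o) with out₁-child o
      ... | inj₁ refl = inj₂ (end , inj₂ (refl , refl))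
      ... | inj₂ (c , oc , pc≡u) = inj₁ (c , inj₂ oc , pc≡u)

      in-child′ : ∀ {u} → Union In In₁ u →
        ∃[ c ] (Union In In₁ c × parent c ≡ u) ⊎ ∃[ s ] Cross′ s u
      in-child′ (inj₁ i) with in-child i
      ... | inj₁ (c , ic , pc≡u) = inj₁ (c , inj₁ ic , pc≡u)
      ... | inj₂ (s , x) = inj₂ (s , inj₁ x)
      in-child′ (inj₂ i) with in₁-child i
      ... | inj₁ refl = inj₂ (start , inj₂ (refl , refl))
      ... | inj₂ (c , ic , pc≡u) = inj₁ (c , inj₂ ic , pc≡u)

      cross′ : ∀ {s t} → Cross′ s t → CrossEdge (Union Out Out₁) (Union In In₁) s t
      cross′ (inj₁ x) = crossEdge-map inj₁ inj₁ (cross x)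
      cross′ (inj₂ (refl , refl)) = bridge

    extend : Orientation
    extend = record
      { Out = Union Out Out₁ ; In = Union In In₁
      ; Out? = λ u → Out? u ⊎-dec Out₁? u ; In? = λ u → In? u ⊎-dec In₁? u
      ; Cross = Cross′
      ; isOrientation = record
        { out∉B = out∉B′ ; in∉B = in∉B′ ; out∩in = out∩in′
        ; out-parent = out-parent′ ; in-parent = in-parent′
        ; out-child = out-child′ ; in-child = in-child′ ; cross = cross′ }
      }

    ⊑-extend : O ⊑ extend
    ⊑-extend = map inj₁ inj₁

  module EarThrough (O : Orientation) {v} (v∉B : v ∉ B) (v-fresh : ¬ Orientation.Covered O v)
                    (pv∈A : parent v ∈ A) where
    open Orientation O

    Below : Fin n → Set
    Below = Ancestor (λ u → u ∉ B) v

    below? : ∀ u → Dec (Below u)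
    below? = ancestor? (λ u∉B → u∉B) (λ u → ¬? (u ∈? B)) v

    below∉B : ∀ {u} → Below u → u ∉ B
    below∉B = ancestor-∉B (λ u∉B → u∉B) v∉B

    below-fresh : ∀ {u} → Below u → ¬ Covered u
    below-fresh here = v-fresh
    below-fresh (up _ b) cov with covered-parent cov
    ... | inj₁ pu∈B = below∉B b pu∈B
    ... | inj₂ cov′ = below-fresh b cov′

    parent-not-below : ¬ Below (parent v)
    parent-not-below b = below∉B b (A⊆B pv∈A)

    Stop : Fin n → Set
    Stop u = Covered u ⊎ u ∈ B

    module _ {x y} (x-below : Below x) (y-not-below : ¬ Below y) (xy : Adj G x y)
             (xy≢pv-v : ¬ IsEdge (parent v) v x y)
             {w} (w-first : Ancestor (λ u → ¬ Stop u) w y) (w-stop : Stop w) where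

      x-parent : parent x ≢ y
      x-parent = leaves x-below xy≢pv-v
        where
        leaves : ∀ {x} → Below x → ¬ IsEdge (parent v) v x y → parent x ≢ y
        leaves here not-pv-v pv≡y = not-pv-v (inj₂ (refl , ≡-sym pv≡y))
        leaves (up _ b) _ px≡y = y-not-below (subst Below px≡y b)

      y-parent : y ∉ B → parent y ≢ x
      y-parent y∉B py≡x = y-not-below (up y∉B (subst Below (≡-sym py≡x) x-below))

      Stem : Fin n → Set
      Stem u = Below u × Ancestor (λ z → z ∉ B) u x

      Climb : Fin n → Set
      Climb u = Ancestor (λ z → ¬ Stop z) u y × ¬ Stop u

      stem? : ∀ u → Dec (Stem u)
      stem? u = below? u ×-dec ancestor? (λ z∉B → z∉B) (λ z → ¬? (z ∈? B)) u x

      climb? : ∀ u → Dec (Climb u)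
      climb? u = ancestor? (_∘ inj₂) (λ z → ¬? (covered? z ⊎-dec z ∈? B)) u y
                 ×-dec ¬? (covered? u ⊎-dec u ∈? B)

      stem-fresh : ∀ {u} → Stem u → ¬ Covered u × u ∉ B
      stem-fresh (b , _) = below-fresh b , below∉B b

      climb-fresh : ∀ {u} → Climb u → ¬ Covered u × u ∉ B
      climb-fresh (_ , ¬stop) = ¬stop ∘ inj₁ , ¬stop ∘ inj₂

      stem∩climb : ∀ {u} → Stem u → ¬ Climb u
      stem∩climb (b , _) (a , _) = y-not-below (ancestor-trans b (ancestor-map (_∘ inj₂) a))

      stem-parent : ∀ {u} → Stem u → parent u ∈ A ⊎ Stem (parent u)
      stem-parent (here , _) = inj₁ pv∈A
      stem-parent (up u∉B b , a) = inj₂ (b , ancestor-trans (up u∉B here) a)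

      climb-parent : ∀ {u} → Climb u → Climb (parent u) ⊎ parent u ≡ w
      climb-parent {u} (a , ¬stop) with covered? (parent u) ⊎-dec parent u ∈? B
      ... | yes stop =
        inj₂ (first-ancestor-unique w-first w-stop (ancestor-trans (up ¬stop here) a) stop)
      ... | no ¬stop′ = inj₁ (ancestor-trans (up ¬stop here) a , ¬stop′)

      stem-child : ∀ {u} → Stem u → u ≡ x ⊎ ∃[ c ] (Stem c × parent c ≡ u)
      stem-child (b , a) with ancestor-child a
      ... | inj₁ u≡x = inj₁ u≡x
      ... | inj₂ (c , a′ , refl , c∉B) = inj₂ (c , (up c∉B b , a′) , refl)

      climb-child : ∀ {u} → Climb u → u ≡ y ⊎ ∃[ c ] (Climb c × parent c ≡ u)
      climb-child (a , _) with ancestor-child a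
      ... | inj₁ u≡y = inj₁ u≡y
      ... | inj₂ (c , a′ , pc≡u , ¬stop) = inj₂ (c , (a′ , ¬stop) , pc≡u)

      y-climbs : Climb y ⊎ y ≡ w
      y-climbs with covered? y ⊎-dec y ∈? B
      ... | yes stop = inj₂ (first-ancestor-unique w-first w-stop here stop)
      ... | no ¬stop = inj₁ (here , ¬stop)

      x-stem : Stem x
      x-stem = x-below , here

      v-stem : Stem v
      v-stem = here , x-below

      -- The climb has to continue the orientation of w; this fixes that of the whole ear.
      outward-ear : w ∈ B ⊎ In w → Ear O
      outward-ear w-in = record
        { Out₁ = Stem ; In₁ = Climb ; Out₁? = stem? ; In₁? = climb? ; start = x ; end = y
        ; out₁-fresh = stem-fresh ; in₁-fresh = climb-fresh ; out₁∩in₁ = stem∩climb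
        ; out₁-parent = map₂ inj₂ ∘ stem-parent
        ; in₁-parent = [ inj₂ ∘ inj₂ , at-w ]′ ∘ climb-parent
        ; out₁-child = stem-child ; in₁-child = climb-child
        ; bridge = record
          { tail-out = inj₂ x-stem
          ; head-in = [ inj₁ ∘ inj₂ , [ inj₂ , inj₁ ∘ inj₁ ]′ ∘ w-kind ]′ y-climbs
          ; adjacent = xy ; tail-parent = x-parent ; head-parent = y-parent }
        }
        where
        w-kind : ∀ {z} → z ≡ w → z ∈ B ⊎ In z
        w-kind refl = w-in
        at-w : ∀ {z} → z ≡ w → z ∈ B ⊎ Union In Climb z
        at-w = map₂ inj₁ ∘ w-kind

      inward-ear : Out w → Ear O
      inward-ear w-out = record
        { Out₁ = Climb ; In₁ = Stem ; Out₁? = climb? ; In₁? = stem? ; start = y ; end = x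
        ; out₁-fresh = climb-fresh ; in₁-fresh = stem-fresh ; out₁∩in₁ = λ c s → stem∩climb s c
        ; out₁-parent = inj₂ ∘ [ inj₂ , inj₁ ∘ w-out′ ]′ ∘ climb-parent
        ; in₁-parent = [ inj₁ ∘ A⊆B , inj₂ ∘ inj₂ ]′ ∘ stem-parent
        ; out₁-child = climb-child ; in₁-child = stem-child
        ; bridge = record
          { tail-out = [ inj₂ , inj₁ ∘ w-out′ ]′ y-climbs
          ; head-in = inj₁ (inj₂ x-stem)
          ; adjacent = sym G xy
          ; tail-parent = y-parent ([ proj₂ ∘ climb-fresh , out∉B ∘ w-out′ ]′ y-climbs)
          ; head-parent = λ _ → x-parent }
        }
        where
        w-out′ : ∀ {z} → z ≡ w → Out z
        w-out′ refl = w-out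

      covering-ear : Σ (Ear O) λ E → Orientation.Covered (extend E) v
      covering-ear = by-kind w-stop
        where
        by-kind : Stop w → Σ (Ear O) λ E → Orientation.Covered (extend E) v
        by-kind (inj₁ (inj₁ w-out)) = inward-ear w-out , inj₂ (inj₂ v-stem)
        by-kind (inj₁ (inj₂ w-in)) = outward-ear (inj₂ w-in) , inj₁ (inj₂ v-stem)
        by-kind (inj₂ w∈B) = outward-ear (inj₁ w∈B) , inj₁ (inj₂ v-stem)

    ear : ContrWalk G B (IsEdge (parent v) v) v (parent v) →
      Σ (Ear O) λ E → Orientation.Covered (extend E) v
    ear detour with leaving-edge below? below∉B detour here parent-not-below
    ... | x , y , x-below , y-not-below , xy , xy≢pv-v
      with first-ancestor (λ u → covered? u ⊎-dec u ∈? B) inj₂ y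
    ...   | w , w-first , w-stop = covering-ear x-below y-not-below xy xy≢pv-v w-first w-stop

  module _ (two-edge : TwoEdgeConnectedContr G B) where

    cover-vertex : ∀ O v → ∃[ O′ ] (O ⊑ O′ × (Nbh G A v → v ∉ B → Orientation.Covered O′ v))
    cover-vertex O v with Orientation.covered? O v | v ∈? B | nbh? G A v
    ... | yes cov | _ | _ = O , (λ c → c) , λ _ _ → cov
    ... | no _ | yes v∈B | _ = O , (λ c → c) , λ _ v∉B → ⊥-elim (v∉B v∈B)
    ... | no _ | no _ | no ¬nbh = O , (λ c → c) , λ nbh _ → ⊥-elim (¬nbh nbh)
    ... | no v-fresh | no v∉B | yes nbh
      with EarThrough.ear O v∉B v-fresh (parent-A nbh v∉B)
             (proj₂ two-edge (parent v) v (sym G (parent-adj v∉B)) (v∉B ∘ proj₂) v (parent v))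
    ...   | E , v-cov = extend E , ⊑-extend E , λ _ _ → v-cov

    cover-list : ∀ vs O →
      ∃[ O′ ] (O ⊑ O′ × (∀ {v} → v ∈ₗ vs → Nbh G A v → v ∉ B → Orientation.Covered O′ v))
    cover-list [] O = O , (λ c → c) , λ ()
    cover-list (v ∷ vs) O with cover-vertex O v
    ... | O₁ , O⊑O₁ , v-cov with cover-list vs O₁
    ...   | O₂ , O₁⊑O₂ , vs-cov =
      O₂ , (λ c → O₁⊑O₂ (O⊑O₁ c)) ,
      λ { (here refl) nbh v∉B → O₁⊑O₂ (v-cov nbh v∉B) ; (there v∈vs) → vs-cov v∈vs }

    covering : ∃[ O ] (∀ {v} → Nbh G A v → v ∉ B → Orientation.Covered O v)
    covering with cover-list (allFin n) ∅-orientation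
    ... | O , _ , cov = O , cov (∈-allFin _)

  module Subgraph (1≤k : 1 ≤ k) (O : Orientation) where
    open Orientation O

    Arrow : Fin n → Fin n → Set
    Arrow u v = (Out v × parent v ≡ u) ⊎ (In u × parent u ≡ v) ⊎ Cross u v

    Vertex : Fin n → Set
    Vertex u = Covered u ⊎ u ∈ A ⊎ (u ∈ B × ∃[ w ] Arrow w u)

    arrow-tail : ∀ {u v} → Arrow u v → Vertex u
    arrow-tail (inj₁ (o , refl)) = [ inj₂ ∘ inj₁ , inj₁ ∘ inj₁ ]′ (out-parent o)
    arrow-tail (inj₂ (inj₁ (i , _))) = inj₁ (inj₂ i)
    arrow-tail (inj₂ (inj₂ x)) = inj₁ (inj₁ (tail-out (cross x)))

    arrow-head : ∀ {u v} → Arrow u v → Vertex v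
    arrow-head (inj₁ (o , _)) = inj₁ (inj₁ o)
    arrow-head arrow@(inj₂ (inj₁ (i , refl))) =
      [ (λ b → inj₂ (inj₂ (b , _ , arrow))) , inj₁ ∘ inj₂ ]′ (in-parent i)
    arrow-head arrow@(inj₂ (inj₂ x)) =
      [ inj₁ ∘ inj₂ , (λ b → inj₂ (inj₂ (b , _ , arrow))) ]′ (head-in (cross x))

    arrow-edge : ∀ {u v} → Arrow u v → Adj G u v
    arrow-edge (inj₁ (o , refl)) = sym G (parent-adj (out∉B o))
    arrow-edge (inj₂ (inj₁ (i , refl))) = parent-adj (in∉B i)
    arrow-edge (inj₂ (inj₂ x)) = adjacent (cross x)

    arrow-notB : ∀ {u v} → Arrow u v → ¬ (u ∈ B × v ∈ B)
    arrow-notB (inj₁ (o , _)) (_ , v∈B) = out∉B o v∈B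
    arrow-notB (inj₂ (inj₁ (i , _))) (u∈B , _) = in∉B i u∈B
    arrow-notB (inj₂ (inj₂ x)) (u∈B , _) = out∉B (tail-out (cross x)) u∈B

    arrows-oriented : ∀ {u v} → Arrow u v → ¬ Arrow v u
    arrows-oriented (inj₁ (ov , pv≡u)) (inj₁ (ou , pu≡v)) =
      parent-no-2-cycle (out∉B ou) (out∉B ov) pu≡v pv≡u
    arrows-oriented (inj₁ (ov , _)) (inj₂ (inj₁ (iv , _))) = out∩in ov iv
    arrows-oriented (inj₁ (_ , pv≡u)) (inj₂ (inj₂ x)) = tail-parent (cross x) pv≡u
    arrows-oriented (inj₂ (inj₁ (iu , _))) (inj₁ (ou , _)) = out∩in ou iu
    arrows-oriented (inj₂ (inj₁ (iu , pu≡v))) (inj₂ (inj₁ (iv , pv≡u))) =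
      parent-no-2-cycle (in∉B iu) (in∉B iv) pu≡v pv≡u
    arrows-oriented (inj₂ (inj₁ (iu , pu≡v))) (inj₂ (inj₂ x)) = head-parent (cross x) (in∉B iu) pu≡v
    arrows-oriented (inj₂ (inj₂ x)) (inj₁ (_ , pu≡v)) = tail-parent (cross x) pu≡v
    arrows-oriented (inj₂ (inj₂ x)) (inj₂ (inj₁ (iv , pv≡u))) = head-parent (cross x) (in∉B iv) pv≡u
    arrows-oriented (inj₂ (inj₂ x)) (inj₂ (inj₂ y)) =
      [ out∩in (tail-out (cross x)) , out∉B (tail-out (cross x)) ]′ (head-in (cross y))

    H : OrientedSubgraph G B
    H = record
      { VH = Vertex ; Arc = Arrow ; arc-tail = arrow-tail ; arc-head = arrow-head
      ; arc-edge = arrow-edge ; arc-notB = arrow-notB ; oriented = arrows-oriented }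

    FromA : Fin n → ℕ → Set
    FromA u m = ∃[ a ] (a ∈ A × ∃[ ℓ ] (ℓ ≤ m × Walk Arrow a u ℓ))

    -- Charging level b for the endpoint covers both alternatives of the theorem at once,
    -- since level b ≥ 1 unless b ∈ A.
    ToB : Fin n → ℕ → Set
    ToB u m = ∃[ b ] (b ∈ B × ∃[ ℓ ] (ℓ + level b ≤ m × Walk Arrow u b ℓ))

    fromA-here : ∀ {a m} → a ∈ A → FromA a m
    fromA-here a∈A = _ , a∈A , 0 , z≤n , []

    fromA-snoc : ∀ {u w m} → FromA u m → Arrow u w → FromA w (suc m)
    fromA-snoc (a , a∈A , ℓ , ℓ≤m , walk) e = a , a∈A , suc ℓ , s≤s ℓ≤m , walk-snoc walk e

    fromA-weaken : ∀ {u m m′} → FromA u m → m ≤ m′ → FromA u m′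
    fromA-weaken (a , a∈A , ℓ , ℓ≤m , walk) m≤m′ = a , a∈A , ℓ , ≤-trans ℓ≤m m≤m′ , walk

    toB-here : ∀ {b} → b ∈ B → ToB b (level b)
    toB-here b∈B = _ , b∈B , 0 , ≤-refl , []

    toB-cons : ∀ {u w m} → Arrow u w → ToB w m → ToB u (suc m)
    toB-cons e (b , b∈B , ℓ , bound , walk) = b , b∈B , suc ℓ , s≤s bound , e ∷ walk

    toB-weaken : ∀ {u m m′} → ToB u m → m ≤ m′ → ToB u m′
    toB-weaken (b , b∈B , ℓ , bound , walk) m≤m′ = b , b∈B , ℓ , ≤-trans bound m≤m′ , walk

    out-fromA : ∀ {u} → Out u → FromA u (level u)
    out-fromA {u} = parent-rec (λ u → Out u → FromA u (level u)) go u
      where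
      go : ∀ u → (u ∉ B → Out (parent u) → FromA (parent u) (level (parent u))) →
        Out u → FromA u (level u)
      go u rec o = fromA-weaken
        (fromA-snoc ([ fromA-here , rec (out∉B o) ]′ (out-parent o)) (inj₁ (o , refl)))
        (parent-level (out∉B o))

    in-toB : ∀ {u} → In u → ToB u (level u)
    in-toB {u} = parent-rec (λ u → In u → ToB u (level u)) go u
      where
      go : ∀ u → (u ∉ B → In (parent u) → ToB (parent u) (level (parent u))) →
        In u → ToB u (level u)
      go u rec i = toB-weaken
        (toB-cons (inj₂ (inj₁ (i , refl))) ([ toB-here , rec (in∉B i) ]′ (in-parent i)))
        (parent-level (in∉B i))

    head-toB : ∀ {t} → In t ⊎ t ∈ B → ToB t (level t)
    head-toB = [ in-toB , toB-here ]′

    Within2k+1 : (Fin n → ℕ → Set) → Fin n → Set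
    Within2k+1 R u = ∃[ m ] (R u m × m + level u ≤ suc (2 * k))

    k+k≡2*k : k + k ≡ 2 * k
    k+k≡2*k = cong (k +_) (≡-sym (+-identityʳ k))

    two-levels : ∀ u w → suc (level u) + level w ≤ suc (2 * k)
    two-levels u w = s≤s (≤-trans (+-mono-≤ (level≤k u) (level≤k w)) (≤-reflexive k+k≡2*k))

    out-toB : ∀ {u} → Out u → Within2k+1 ToB u
    out-toB {u} = child-rec (λ u → Out u → Within2k+1 ToB u) go u
      where
      go : ∀ u → (∀ {c} → c ∉ B → parent c ≡ u → Out c → Within2k+1 ToB c) → Out u → Within2k+1 ToB u
      go u rec o with out-child o
      ... | inj₁ (c , oc , pc≡u) with rec (out∉B oc) pc≡u oc
      ...   | m , R , bound =
        suc m , toB-cons (inj₁ (oc , pc≡u)) R , m+n≤o⇒1+m+n′≤o (child-level (out∉B oc) pc≡u) bound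
      go u rec o | inj₂ (t , x) =
        suc (level t) , toB-cons (inj₂ (inj₂ x)) (head-toB (head-in (cross x))) , two-levels t u

    in-fromA : ∀ {u} → In u → Within2k+1 FromA u
    in-fromA {u} = child-rec (λ u → In u → Within2k+1 FromA u) go u
      where
      go : ∀ u → (∀ {c} → c ∉ B → parent c ≡ u → In c → Within2k+1 FromA c) → In u → Within2k+1 FromA u
      go u rec i with in-child i
      ... | inj₁ (c , ic , pc≡u) with rec (in∉B ic) pc≡u ic
      ...   | m , F , bound =
        suc m , fromA-snoc F (inj₂ (inj₁ (ic , pc≡u))) ,
        m+n≤o⇒1+m+n′≤o (child-level (in∉B ic) pc≡u) bound
      go u rec i | inj₂ (s , x) =
        suc (level s) , fromA-snoc (out-fromA (tail-out (cross x))) (inj₂ (inj₂ x)) , two-levels s u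

    walk-vertex : ∀ {u b ℓ} → Walk Arrow u b ℓ → Vertex u → Vertex b
    walk-vertex [] u∈H = u∈H
    walk-vertex (e ∷ walk) _ = walk-vertex walk (arrow-head e)

    FromA≤2k Returns≤2k : Fin n → Set
    FromA≤2k u = DDistLe H (InSub A) (Single u) (2 * k)
    Returns≤2k u = DDistLe H (Single u) (InSub A) (2 * k) ⊎
                    DDistLe H (Single u) (Minus (InSub B) (InSub A)) (2 * k ∸ 1)

    fromA-dist : ∀ {u m} → FromA u m → m ≤ 2 * k → Vertex u → FromA≤2k u
    fromA-dist (a , a∈A , ℓ , ℓ≤m , walk) m≤2k u∈H =
      a , _ , a∈A , refl , inj₂ (inj₁ a∈A) , u∈H , ℓ , ≤-trans ℓ≤m m≤2k , walk

    toB-dist : ∀ {u m} → ToB u m → m ≤ 2 * k → Vertex u → Returns≤2k u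
    toB-dist (b , b∈B , ℓ , bound , walk) m≤2k u∈H with b ∈? A
    ... | yes b∈A = inj₁ (_ , b , refl , b∈A , u∈H , walk-vertex walk u∈H , ℓ ,
                          ≤-trans (m≤m+n ℓ (level b)) (≤-trans bound m≤2k) , walk)
    ... | no b∉A = inj₂ (_ , b , refl , (b∈B , b∉A) , u∈H , walk-vertex walk u∈H , ℓ ,
                         m+n≤o⇒m≤o∸1 (level≥1 b∉A) (≤-trans bound m≤2k) , walk)

    within2k+1⇒2k : ∀ {u m} → u ∉ B → m + level u ≤ suc (2 * k) → m ≤ 2 * k
    within2k+1⇒2k u∉B = m+n≤o⇒m≤o∸1 (level≥1 (∉B⇒∉A u∉B))

    level≤2k : ∀ u → level u ≤ 2 * k
    level≤2k u = ≤-trans (level≤k u) (m≤m+n k _)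

    A-distances : ∀ {u} → u ∈ A → Vertex u → FromA≤2k u × Returns≤2k u
    A-distances u∈A u∈H =
      fromA-dist (fromA-here u∈A) z≤n u∈H , inj₁ (_ , _ , refl , u∈A , u∈H , u∈H , 0 , z≤n , [])

    distances : ∀ u → Vertex u → FromA≤2k u × Returns≤2k u
    distances u u∈H@(inj₁ (inj₁ o)) with out-toB o
    ... | m , R , bound =
      fromA-dist (out-fromA o) (level≤2k u) u∈H , toB-dist R (within2k+1⇒2k (out∉B o) bound) u∈H
    distances u u∈H@(inj₁ (inj₂ i)) with in-fromA i
    ... | m , F , bound =
      fromA-dist F (within2k+1⇒2k (in∉B i) bound) u∈H , toB-dist (in-toB i) (level≤2k u) u∈H
    distances u u∈H@(inj₂ (inj₁ u∈A)) = A-distances u∈A u∈H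
    distances u u∈H@(inj₂ (inj₂ (u∈B , w , arc))) with u ∈? A
    ... | yes u∈A = A-distances u∈A u∈H
    ... | no u∉A = into u∉A arc , inj₂ (_ , _ , refl , (u∈B , u∉A) , u∈H , u∈H , 0 , z≤n , [])
      where
      into : u ∉ A → Arrow w u → FromA≤2k u
      into _ (inj₁ (o , _)) = ⊥-elim (out∉B o u∈B)
      into u∉A arc@(inj₂ (inj₁ (i , pw≡u))) with in-fromA i
      ... | m , F , bound = fromA-dist (fromA-snoc F arc)
        (m+n≤o⇒m≤o∸1 (level≥1 u∉A) (m+n≤o⇒1+m+n′≤o (child-level (in∉B i) pw≡u) bound)) u∈H
      into _ arc@(inj₂ (inj₂ x)) = fromA-dist (fromA-snoc (out-fromA (tail-out (cross x))) arc)
        (≤-trans (s≤s (level≤k w)) (≤-trans (+-monoˡ-≤ k 1≤k) (≤-reflexive k+k≡2*k))) u∈H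

lemma4 : ∀ {n} (G : Graph n) (k : ℕ) (A B : Subset n) → 1 ≤ k →
    SubsetOf A B →
    StepDominating G k (InSub B) →
    TwoEdgeConnectedContr G B →
    StepDominating G (k ∸ 1) (Union (Nbh G A) (InSub B)) →
    Σ (OrientedSubgraph G B) λ H →
      (∀ v → Minus (Nbh G A) (InSub B) v → VH H v) ×
      StepDominating G (k ∸ 1) (Union (VH H) (InSub B)) ×
      (∀ v → VH H v →
        DDistLe H (InSub A) (Single v) (2 * k) ×
        (DDistLe H (Single v) (InSub A) (2 * k) ⊎
         DDistLe H (Single v) (Minus (InSub B) (InSub A)) (2 * k ∸ 1)))
lemma4 G k A B 1≤k A⊆B _ two-edge dom =
  H , (λ v (nbh , v∉B) → inj₁ (covers nbh v∉B)) ,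
  stepDominating-mono {G = G} near⇒H dom ,
  distances
  where
  open Forest A⊆B (layering 1≤k A⊆B dom)

  O : Orientation
  O = proj₁ (covering two-edge)

  covers : ∀ {v} → Nbh G A v → v ∉ B → Orientation.Covered O v
  covers = proj₂ (covering two-edge)

  open Subgraph 1≤k O

  near⇒H : ∀ {v} → Union (Nbh G A) (InSub B) v → Union (VH H) (InSub B) v
  near⇒H {v} (inj₁ nbh) with v ∈? B
  ... | yes v∈B = inj₂ v∈B
  ... | no v∉B = inj₁ (inj₁ (covers nbh v∉B))
  near⇒H (inj₂ v∈B) = inj₂ v∈B
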